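{- Let $n\geq2$ and let $l=3^m l_1$ be an even positive integer with $\gcd(3,l_1)=1$ and $m\geq 0$. Then $$\varepsilon_1(n,l)=n^{l/2}\left(\pi_n(l)+1\right)+\pi_n\!\left(\frac{3l}{2}\right)-n^{3l/2}.$$
   Context: A nonempty word $u$ is primitive if $u=v^m$ with $m$ a positive integer implies $m=1$; $|u|$ is the length of $u$. $\pi_n(k)$ denotes the number of primitive words of length $k$ over an alphabet of size $n$. For an alphabet $\mathcal{A}$ of size $n$, $\mathcal{E}_1(\mathcal{A},l)$ is the set of pairs $(p,q)$ of primitive words over $\mathcal{A}$ with $|p|=2|q|=2l$, $pq$ not primitive, and $p=xqx$ for some nonempty word $x$ with $xq$ primitive and $|q|=2|x|$. $\varepsilon_1(n,l)=|\mathcal{E}_1(\mathcal{A},l)|$. -}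

module Defs where

open import Data.Nat using (ℕ; zero; suc; _*_; _≤_)
open import Data.Fin using (Fin)
open import Data.List using (List; []; _++_; length)
open import Data.List.Membership.Propositional using (_∈_)
open import Data.List.Relation.Unary.Unique.Propositional using (Unique)
open import Data.Product using (Σ; _×_; ∃; _,_)
open import Function.Bundles using (_⇔_)
open import Relation.Binary.PropositionalEquality using (_≡_)
open import Relation.Nullary using (¬_)

Word : ℕ → Set
Word n = List (Fin n)

_^ʷ_ : ∀ {n} → Word n → ℕ → Word n
v ^ʷ zero  = []
v ^ʷ suc m = v ++ (v ^ʷ m)

Primitive : ∀ {n} → Word n → Set
Primitive u = ¬ (u ≡ []) × (∀ v m → 1 ≤ m → u ≡ v ^ʷ m → m ≡ 1)

HasCard : ∀ {A : Set} → (A → Set) → ℕ → Set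
HasCard {A} P c =
  Σ (List A) λ xs → Unique xs × (∀ x → (x ∈ xs) ⇔ P x) × length xs ≡ c

-- Primitive words of length k over Fin n (π_n(k) is its cardinality).
PrimOfLength : (n k : ℕ) → Word n → Set
PrimOfLength n k w = length w ≡ k × Primitive w

InE1 : (n l : ℕ) → Word n × Word n → Set
InE1 n l (p , q) =
  Primitive p × Primitive q ×
  length p ≡ 2 * l × length q ≡ l ×
  ¬ Primitive (p ++ q) ×
  ∃ λ (x : Word n) → ¬ (x ≡ []) × p ≡ x ++ q ++ x × Primitive (x ++ q) × length q ≡ 2 * length x

-- Write p = x q x with |x| = k and |q| = 2k. The map (x , q) ↦ (x q x , q) identifies
-- E₁(n, 2k) with the pairs in which both q and x q are primitive: x q x is then primitive
-- by the Fine–Wilf theorem applied to a root length of x q x and its period |x q| = 3k,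
-- while p q = (x q)² is never primitive. Among all n^(3k) pairs (x , q), "q primitive"
-- holds for n^k π(2k) pairs and "x q primitive" for π(3k) (split a word of length 3k),
-- and both fail exactly when q = x x (again by Fine–Wilf), i.e. for n^k pairs.
-- Inclusion–exclusion gives ε₁ + n^(3k) = n^k π(2k) + π(3k) + n^k.

module Submission where

open import Defs
open import Data.Empty using (⊥-elim)
open import Data.Fin using (Fin)
import Data.Fin as Fin
open import Data.List using (List; []; _∷_; _++_; length; take; drop; map; filter; cartesianProduct; allFin)
open import Data.List.Membership.Propositional using (_∈_)
open import Data.List.Membership.Propositional.Properties
  using (∈-map⁺; ∈-map⁻; ∈-filter⁺; ∈-filter⁻; ∈-cartesianProduct⁺; ∈-cartesianProduct⁻; ∈-allFin)
open import Data.List.Membership.Propositional.Properties.WithK using (unique∧set⇒bag)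
open import Data.List.Properties
  using (length-map; length-tabulate; length-++; length-take; length-drop; ++-assoc; ++-cancelˡ;
         ++-identityʳ; take++drop≡id)
open import Data.List.Relation.Binary.BagAndSetEquality using (∼bag⇒↭)
open import Data.List.Relation.Binary.Permutation.Propositional.Properties using (↭-length)
import Data.List.Relation.Unary.All as All
import Data.List.Relation.Unary.AllPairs as AllPairs
open import Data.List.Relation.Unary.Any using (here)
open import Data.List.Relation.Unary.Unique.Propositional using (Unique)
open import Data.List.Relation.Unary.Unique.Propositional.Properties
  using (map⁺; filter⁺; cartesianProduct⁺; allFin⁺)
open import Data.Maybe using (Maybe; just; nothing)
open import Data.Maybe.Properties using (≡-dec)
open import Data.Nat using (ℕ; zero; suc; _+_; _*_; _^_; _∸_; _≤_; _<_; z≤n; s≤s; z<s;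
                            NonZero; ≢-nonZero; >-nonZero)
open import Data.Nat.Coprimality using (Coprime; coprime-divisor; gcd≡1⇒coprime)
import Data.Nat.Coprimality as Coprime
open import Data.Nat.Divisibility
open import Data.Nat.GCD
open import Data.Nat.Properties
open import Data.Nat.Tactic.RingSolver using (solve-∀)
open import Data.Product using (∃-syntax; _×_; _,_; proj₁; proj₂; uncurry)
open import Data.Sum using (inj₁; inj₂)
open import Data.Unit using (⊤)
open import Function using (_∘_; id)
open import Function.Bundles using (_⇔_; mk⇔; Equivalence)
import Function.Properties.Equivalence as ⇔
open import Relation.Binary.Definitions using (tri<; tri≈; tri>)
open import Relation.Binary.PropositionalEquality
  using (_≡_; _≢_; refl; sym; trans; cong; cong₂; subst; subst₂; module ≡-Reasoning)
open import Relation.Nullary using (¬_; Dec; yes; no; ¬?; contradiction)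
open import Relation.Nullary.Decidable using (map′; _×-dec_; _→-dec_; decidable-stable)
open import Relation.Unary using (Decidable; ∁; _∩_)
open import Relation.Unary.Properties using (_∩?_; ∁?)

open ≡-Reasoning

-- Periodic sequences and the Fine–Wilf theorem

PeriodicFrom : {B : Set} → ℕ → ℕ → (ℕ → B) → ℕ → Set
PeriodicFrom s p f L = ∀ i → s ≤ i → i + p < L → f i ≡ f (i + p)

Periodic : {B : Set} → ℕ → (ℕ → B) → ℕ → Set
Periodic = PeriodicFrom 0

gcd[m,m+n]≡gcd[m,n] : ∀ m n → gcd m (m + n) ≡ gcd m n
gcd[m,m+n]≡gcd[m,n] m n = ∣-antisym
  (gcd-greatest (gcd[m,n]∣m m (m + n)) (∣m+n∣m⇒∣n (gcd[m,n]∣n m (m + n)) (gcd[m,n]∣m m (m + n))))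
  (gcd-greatest (gcd[m,n]∣m m n) (∣m∣n⇒∣m+n (gcd[m,n]∣m m n) (gcd[m,n]∣n m n)))

module _ {B : Set} {f : ℕ → B} where

  periodicFrom-* : ∀ {s p L} c → PeriodicFrom s p f L → PeriodicFrom s (c * p) f L
  periodicFrom-* zero    P i _ _ = cong f (sym (+-identityʳ i))
  periodicFrom-* {s} {p} {L} (suc c) P i s≤i i+[p+cp]<L = begin
    f i             ≡⟨ P i s≤i (≤-<-trans (m≤m+n (i + p) (c * p)) i+p+cp<L) ⟩
    f (i + p)       ≡⟨ periodicFrom-* c P (i + p) (≤-trans s≤i (m≤m+n i p)) i+p+cp<L ⟩
    f (i + p + c * p) ≡⟨ cong f (+-assoc i p (c * p)) ⟩
    f (i + (p + c * p)) ∎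
    where
    i+p+cp<L : i + p + c * p < L
    i+p+cp<L = subst (_< L) (sym (+-assoc i p (c * p))) i+[p+cp]<L

  periodicFrom-∣ : ∀ {s p q L} → p ∣ q → PeriodicFrom s p f L → PeriodicFrom s q f L
  periodicFrom-∣ (divides-refl c) = periodicFrom-* c

  periodic-≤ : ∀ {p L M} → M ≤ L → Periodic p f L → Periodic p f M
  periodic-≤ M≤L P i _ i+p<M = P i z≤n (<-≤-trans i+p<M M≤L)

  -- Walking down from s, each position i satisfies f i ≡ f (i + p) ≡ f (i + g),
  -- the second step because p − g is a multiple of g and i + g > i.
  periodicFrom⇒periodic : ∀ {p g L} s → g ∣ p → 0 < p → 0 < g → s + p ≤ L →
                          Periodic p f L → PeriodicFrom s g f L → Periodic g f L
  periodicFrom⇒periodic zero _ _ _ _ _ Pg = Pg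
  periodicFrom⇒periodic {g = g} {L} (suc s) (divides-refl (suc c)) p>0 g>0 s+p<L Pp Pg =
    periodicFrom⇒periodic s (divides-refl (suc c)) p>0 g>0 (<⇒≤ s+p<L) Pp Pg′
    where
    Pg′ : PeriodicFrom s g f L
    Pg′ i s≤i i+g<L with m≤n⇒m<n∨m≡n s≤i
    ... | inj₁ s<i  = Pg i s<i i+g<L
    ... | inj₂ refl = begin
      f s                   ≡⟨ Pp s z≤n s+p<L ⟩
      f (s + (g + c * g))   ≡⟨ cong f (+-assoc s g (c * g)) ⟨
      f (s + g + c * g)     ≡⟨ periodicFrom-* c Pg (s + g) (m<m+n s g>0) (subst (_< L) (sym (+-assoc s g (c * g))) s+p<L) ⟨
      f (s + g)             ∎

  periodic-shift : ∀ {p g M} → Periodic p f (p + M) → Periodic g f M → PeriodicFrom p g f (p + M)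
  periodic-shift {p} {g} {M} Pp Pg i p≤i i+g<p+M with j , refl ← m≤n⇒∃[o]m+o≡n p≤i = begin
    f (p + j)       ≡⟨ cong f (+-comm p j) ⟩
    f (j + p)       ≡⟨ Pp j z≤n (subst (_< p + M) (+-comm p j) (≤-<-trans (m≤m+n (p + j) g) i+g<p+M)) ⟨
    f j             ≡⟨ Pg j z≤n j+g<M ⟩
    f (j + g)       ≡⟨ Pp (j + g) z≤n (subst (_< p + M) (+-comm p (j + g)) (+-monoʳ-< p j+g<M)) ⟩
    f (j + g + p)   ≡⟨ cong f (+-comm (j + g) p) ⟩
    f (p + (j + g)) ≡⟨ cong f (+-assoc p j g) ⟨
    f (p + j + g)   ∎
    where
    j+g<M : j + g < M
    j+g<M = +-cancelˡ-< p (j + g) M (subst (_< p + M) (+-assoc p j g) i+g<p+M)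

  periodic-difference : ∀ {p r M} → Periodic p f (p + M) → Periodic (p + r) f (p + M) → Periodic r f M
  periodic-difference {p} {r} {M} Pp Ppr i _ i+r<M = begin
    f i             ≡⟨ Ppr i z≤n (subst (_< p + M) (sym i+[p+r]≡[i+r]+p) i+r+p<p+M) ⟩
    f (i + (p + r)) ≡⟨ cong f i+[p+r]≡[i+r]+p ⟩
    f (i + r + p)   ≡⟨ Pp (i + r) z≤n i+r+p<p+M ⟨
    f (i + r)       ∎
    where
    i+r+p<p+M : i + r + p < p + M
    i+r+p<p+M = subst (_< p + M) (+-comm p (i + r)) (+-monoʳ-< p i+r<M)
    i+[p+r]≡[i+r]+p : i + (p + r) ≡ i + r + p
    i+[p+r]≡[i+r]+p = trans (cong (i +_) (+-comm p r)) (sym (+-assoc i r p))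

  private
    fine-wilf-bounded : ∀ N {p q L} → p + q ≤ N → Periodic p f L → Periodic q f L →
                        p + q ≤ L + gcd p q → Periodic (gcd p q) f L
    fine-wilf-step : ∀ N {p r L} → p + (p + r) ≤ N → Periodic p f L → Periodic (p + r) f L →
                     p + (p + r) ≤ L + gcd p r → Periodic (gcd p r) f L

    fine-wilf-bounded N {p} {q} p+q≤N Pp Pq bound with ≤-total p q
    ... | inj₁ p≤q with r , refl ← m≤n⇒∃[o]m+o≡n p≤q
      rewrite gcd[m,m+n]≡gcd[m,n] p r = fine-wilf-step N p+q≤N Pp Pq bound
    fine-wilf-bounded N {p} {q} p+q≤N Pp Pq bound | inj₂ q≤p with r , refl ← m≤n⇒∃[o]m+o≡n q≤p
      rewrite gcd-comm p q | gcd[m,m+n]≡gcd[m,n] q r | +-comm p q = fine-wilf-step N p+q≤N Pq Pp bound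

    fine-wilf-step N {zero} {r} {L} _ _ Pr _ = subst (λ g → Periodic g f L) (sym (gcd-identityˡ r)) Pr
    fine-wilf-step N {suc p} {zero} {L} _ Pp _ _ = subst (λ g → Periodic g f L) (sym (gcd-identityʳ (suc p))) Pp
    -- Euclid's step for the periods p and p + r: both p and r are periods of the prefix of
    -- length L ∸ p, so gcd p r is one by induction; as p is a period, that prefix reappears
    -- from position p on, and periodicFrom⇒periodic carries gcd p r back to the start.
    fine-wilf-step (suc N) {p@(suc p′)} {r@(suc _)} {L} (s≤s p′+[p+r]≤N) Pp Ppr bound =
      subst (Periodic g f) (sym L≡p+M)
        (periodicFrom⇒periodic p (gcd[m,n]∣m p r) z<s g>0 (+-monoʳ-≤ p p≤M) Pp′
          (periodic-shift Pp′ (fine-wilf-bounded N p+r≤N PpM PrM p+r≤M+g)))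
      where
      g = gcd p r
      g>0 : 0 < g
      g>0 = n≢0⇒n>0 (gcd[m,n]≢0 p r (inj₁ λ ()))
      p+p+r≤L+r : p + p + r ≤ L + r
      p+p+r≤L+r = ≤-trans (≤-reflexive (+-assoc p p r)) (≤-trans bound (+-monoʳ-≤ L (∣⇒≤ (gcd[m,n]∣n p r))))
      p+p≤L : p + p ≤ L
      p+p≤L = +-cancelʳ-≤ r (p + p) L p+p+r≤L+r
      M = L ∸ p
      L≡p+M : L ≡ p + M
      L≡p+M = sym (m+[n∸m]≡n (≤-trans (m≤m+n p p) p+p≤L))
      Pp′ : Periodic p f (p + M)
      Pp′ = subst (Periodic p f) L≡p+M Pp
      PpM : Periodic p f M
      PpM = periodic-≤ (m≤n+m M p) Pp′
      PrM : Periodic r f M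
      PrM = periodic-difference Pp′ (subst (Periodic (p + r) f) L≡p+M Ppr)
      p≤M : p ≤ M
      p≤M = +-cancelˡ-≤ p p M (subst (p + p ≤_) L≡p+M p+p≤L)
      p+r≤N : p + r ≤ N
      p+r≤N = ≤-trans (m≤n+m (p + r) p′) p′+[p+r]≤N
      p+r≤M+g : p + r ≤ M + g
      p+r≤M+g = +-cancelˡ-≤ p (p + r) (M + g)
        (subst (p + (p + r) ≤_) (trans (cong (_+ g) L≡p+M) (+-assoc p M g)) bound)

  fine-wilf : ∀ {p q L} → Periodic p f L → Periodic q f L → p + q ≤ L + gcd p q → Periodic (gcd p q) f L
  fine-wilf {p} {q} = fine-wilf-bounded (p + q) ≤-refl

  fine-wilf-∣ : ∀ {p q L d} → 0 < p → d ∣ p → d ∣ q → p + q ≤ L + d →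
                Periodic p f L → Periodic q f L → Periodic (gcd p q) f L
  fine-wilf-∣ {p} {q} {L} p>0 d∣p d∣q bound Pp Pq = fine-wilf Pp Pq (≤-trans bound (+-monoʳ-≤ L d≤gcd))
    where
    d≤gcd : _ ≤ gcd p q
    d≤gcd = ∣⇒≤ ⦃ ≢-nonZero (gcd[m,n]≢0 p q (inj₁ (m<n⇒n≢0 p>0))) ⦄ (gcd-greatest d∣p d∣q)

-- Periods of words

-- A word w is read as the sequence at w; its periods are those of at w below length w.
at : {A : Set} → List A → ℕ → Maybe A
at []       _       = nothing
at (x ∷ xs) zero    = just x
at (x ∷ xs) (suc i) = at xs i

module _ {A : Set} where

  at-++ˡ : ∀ (xs : List A) {ys i} → i < length xs → at (xs ++ ys) i ≡ at xs i
  at-++ˡ (x ∷ xs) {i = zero}  _         = refl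
  at-++ˡ (x ∷ xs) {i = suc i} (s≤s i<n) = at-++ˡ xs i<n

  at-++ʳ : ∀ (xs : List A) {ys} i → at (xs ++ ys) (length xs + i) ≡ at ys i
  at-++ʳ []       i = refl
  at-++ʳ (x ∷ xs) i = at-++ʳ xs i

  at-drop : ∀ g (xs : List A) i → at (drop g xs) i ≡ at xs (g + i)
  at-drop zero    xs       i = refl
  at-drop (suc g) []       i = refl
  at-drop (suc g) (x ∷ xs) i = at-drop g xs i

  at-take : ∀ g (xs : List A) {i} → i < g → at (take g xs) i ≡ at xs i
  at-take (suc g) []       _         = refl
  at-take (suc g) (x ∷ xs) {zero}  _ = refl
  at-take (suc g) (x ∷ xs) {suc i} (s≤s i<g) = at-take g xs i<g

  at-≥length : ∀ (xs : List A) {i} → length xs ≤ i → at xs i ≡ nothing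
  at-≥length []       _         = refl
  at-≥length (x ∷ xs) (s≤s n≤i) = at-≥length xs n≤i

  at-injective : ∀ {xs ys : List A} → (∀ i → at xs i ≡ at ys i) → xs ≡ ys
  at-injective {[]}     {[]}     _  = refl
  at-injective {[]}     {y ∷ ys} eq with () ← eq 0
  at-injective {x ∷ xs} {[]}     eq with () ← eq 0
  at-injective {x ∷ xs} {y ∷ ys} eq with refl ← eq 0 = cong (x ∷_) (at-injective (eq ∘ suc))

  take-length-++ : ∀ (xs : List A) {ys} → take (length xs) (xs ++ ys) ≡ xs
  take-length-++ []       = refl
  take-length-++ (x ∷ xs) = cong (x ∷_) (take-length-++ xs)

  drop-length-++ : ∀ (xs : List A) {ys} → drop (length xs) (xs ++ ys) ≡ ys
  drop-length-++ []       = refl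
  drop-length-++ (x ∷ xs) = drop-length-++ xs

  periodic-prefix : ∀ (u : List A) {v g} → Periodic g (at (u ++ v)) (length (u ++ v)) →
                    Periodic g (at u) (length u)
  periodic-prefix u {v} {g} P i _ i+g<u = begin
    at u i             ≡⟨ at-++ˡ u (≤-<-trans (m≤m+n i g) i+g<u) ⟨
    at (u ++ v) i      ≡⟨ P i z≤n (<-≤-trans i+g<u u≤uv) ⟩
    at (u ++ v) (i + g) ≡⟨ at-++ˡ u i+g<u ⟩
    at u (i + g)       ∎
    where
    u≤uv : length u ≤ length (u ++ v)
    u≤uv = subst (length u ≤_) (sym (length-++ u)) (m≤m+n (length u) (length v))

  periodic-suffix : ∀ (u : List A) {v g} → Periodic g (at (u ++ v)) (length (u ++ v)) →
                    Periodic g (at v) (length v)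
  periodic-suffix u {v} {g} P i _ i+g<v = begin
    at v i                         ≡⟨ at-++ʳ u i ⟨
    at (u ++ v) (length u + i)       ≡⟨ P (length u + i) z≤n u+i+g<uv ⟩
    at (u ++ v) (length u + i + g)   ≡⟨ cong (at (u ++ v)) (+-assoc (length u) i g) ⟩
    at (u ++ v) (length u + (i + g)) ≡⟨ at-++ʳ u (i + g) ⟩
    at v (i + g)                   ∎
    where
    u+i+g<uv : length u + i + g < length (u ++ v)
    u+i+g<uv = subst₂ _<_ (sym (+-assoc (length u) i g)) (sym (length-++ u)) (+-monoʳ-< (length u) i+g<v)

  periodic⇒periodicFrom-++ : ∀ (u : List A) {v g} → Periodic g (at v) (length v) →
                             PeriodicFrom (length u) g (at (u ++ v)) (length (u ++ v))
  periodic⇒periodicFrom-++ u {v} {g} P i u≤i i+g<uv with j , refl ← m≤n⇒∃[o]m+o≡n u≤i = begin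
    at (u ++ v) (length u + j)       ≡⟨ at-++ʳ u j ⟩
    at v j                         ≡⟨ P j z≤n j+g<v ⟩
    at v (j + g)                   ≡⟨ at-++ʳ u (j + g) ⟨
    at (u ++ v) (length u + (j + g)) ≡⟨ cong (at (u ++ v)) (+-assoc (length u) j g) ⟨
    at (u ++ v) (length u + j + g)   ∎
    where
    j+g<v : j + g < length v
    j+g<v = +-cancelˡ-< (length u) (j + g) (length v) (subst₂ _<_ (+-assoc (length u) j g) (length-++ u) i+g<uv)

  bordered-periodic : ∀ (x t : List A) → Periodic (length (x ++ t)) (at (x ++ t ++ x)) (length (x ++ t ++ x))
  bordered-periodic x t i _ i+p<w = begin
    at (x ++ t ++ x) i        ≡⟨ at-++ˡ x i<x ⟩
    at x i                    ≡⟨ at-++ʳ (x ++ t) i ⟨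
    at ((x ++ t) ++ x) (length (x ++ t) + i) ≡⟨ cong₂ at (++-assoc x t x) (+-comm (length (x ++ t)) i) ⟩
    at (x ++ t ++ x) (i + length (x ++ t)) ∎
    where
    i<x : i < length x
    i<x = +-cancelˡ-< (length (x ++ t)) i (length x)
            (subst₂ _<_ (+-comm i _) (trans (cong length (sym (++-assoc x t x))) (length-++ (x ++ t))) i+p<w)

  take-drop-periodic : ∀ {g} (w : List A) → Periodic g (at w) (length w) → g + g ≤ length w →
                       take g (drop g w) ≡ take g w
  take-drop-periodic {g} w P g+g≤w = at-injective agree
    where
    agree : ∀ i → at (take g (drop g w)) i ≡ at (take g w) i
    agree i with i <? g
    ... | yes i<g = begin
      at (take g (drop g w)) i ≡⟨ at-take g (drop g w) i<g ⟩
      at (drop g w) i          ≡⟨ at-drop g w i ⟩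
      at w (g + i)             ≡⟨ cong (at w) (+-comm g i) ⟩
      at w (i + g)             ≡⟨ P i z≤n (<-≤-trans (+-monoˡ-< g i<g) g+g≤w) ⟨
      at w i                   ≡⟨ at-take g w i<g ⟨
      at (take g w) i          ∎
    ... | no i≮g = trans (at-≥length (take g (drop g w)) (take-short (drop g w))) (sym (at-≥length (take g w) (take-short w)))
      where
      take-short : ∀ xs → length (take g xs) ≤ i
      take-short xs = ≤-trans (≤-reflexive (length-take g xs)) (≤-trans (m⊓n≤m g _) (≮⇒≥ i≮g))

-- Primitive words

HasProperPeriod : {A : Set} → List A → Set
HasProperPeriod w = ∃[ g ] g < length w × g ∣ length w × Periodic g (at w) (length w)

module _ {n : ℕ} where

  length-^ʷ : ∀ (v : Word n) m → length (v ^ʷ m) ≡ m * length v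
  length-^ʷ v zero    = refl
  length-^ʷ v (suc m) = trans (length-++ v) (cong (length v +_) (length-^ʷ v m))

  []-^ʷ : ∀ m → [] ^ʷ m ≡ [] {A = Fin n}
  []-^ʷ zero    = refl
  []-^ʷ (suc m) = []-^ʷ m

  ^ʷ-sucʳ : ∀ (v : Word n) m → v ^ʷ suc m ≡ v ^ʷ m ++ v
  ^ʷ-sucʳ v zero    = ++-identityʳ v
  ^ʷ-sucʳ v (suc m) = trans (cong (v ++_) (^ʷ-sucʳ v m)) (sym (++-assoc v (v ^ʷ m) v))

  ^ʷ-periodic : ∀ (v : Word n) m → Periodic (length v) (at (v ^ʷ m)) (length (v ^ʷ m))
  ^ʷ-periodic v (suc m) i _ i+v<vm = begin
    at (v ^ʷ suc m) i         ≡⟨ cong (λ w → at w i) (^ʷ-sucʳ v m) ⟩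
    at (v ^ʷ m ++ v) i        ≡⟨ at-++ˡ (v ^ʷ m) i<vᵐ ⟩
    at (v ^ʷ m) i             ≡⟨ at-++ʳ v i ⟨
    at (v ^ʷ suc m) (length v + i) ≡⟨ cong (at (v ^ʷ suc m)) (+-comm (length v) i) ⟩
    at (v ^ʷ suc m) (i + length v) ∎
    where
    i<vᵐ : i < length (v ^ʷ m)
    i<vᵐ = +-cancelˡ-< (length v) i _ (subst₂ _<_ (+-comm i (length v)) (length-++ v) i+v<vm)

  periodic⇒^ʷ : ∀ {g} m (w : Word n) → g * m ≡ length w → Periodic g (at w) (length w) →
                w ≡ take g w ^ʷ m
  periodic⇒^ʷ {g} zero [] _ _ = refl
  periodic⇒^ʷ {g} zero (_ ∷ _) g*0≡suc with () ← trans (sym (*-zeroʳ g)) g*0≡suc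
  periodic⇒^ʷ {g} (suc m) w g*[1+m]≡w P = begin
    w                                  ≡⟨ take++drop≡id g w ⟨
    take g w ++ drop g w               ≡⟨ cong (take g w ++_) (periodic⇒^ʷ m (drop g w) g*m≡rest P-rest) ⟩
    take g w ++ take g (drop g w) ^ʷ m ≡⟨ cong (take g w ++_) (same-root m g*[1+m]≡w) ⟩
    take g w ++ take g w ^ʷ m          ∎
    where
    g*m≡rest : g * m ≡ length (drop g w)
    g*m≡rest = sym (begin
      length (drop g w)  ≡⟨ length-drop g w ⟩
      length w ∸ g       ≡⟨ cong (_∸ g) (trans (sym g*[1+m]≡w) (*-suc g m)) ⟩
      g + g * m ∸ g      ≡⟨ m+n∸m≡n g (g * m) ⟩
      g * m              ∎)
    P-rest : Periodic g (at (drop g w)) (length (drop g w))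
    P-rest = periodic-suffix (take g w) (subst (λ u → Periodic g (at u) (length u)) (sym (take++drop≡id g w)) P)
    same-root : ∀ k → g * suc k ≡ length w → take g (drop g w) ^ʷ k ≡ take g w ^ʷ k
    same-root zero    _  = refl
    same-root (suc k) eq = cong (_^ʷ suc k) (take-drop-periodic w P
      (subst (g + g ≤_) (trans (sym (*-suc g (suc k))) eq) (+-monoʳ-≤ g (m≤m*n g (suc k)))))

  ^ʷ-hasProperPeriod : ∀ (v : Word n) m → 0 < length v → HasProperPeriod (v ^ʷ (2 + m))
  ^ʷ-hasProperPeriod v m v>0 =
    length v , v<vᵐ , divides (2 + m) (length-^ʷ v (2 + m)) , ^ʷ-periodic v (2 + m)
    where
    v<vᵐ : length v < length (v ^ʷ (2 + m))
    v<vᵐ = subst (length v <_) (sym (length-^ʷ v (2 + m))) (m<m+n (length v) (<-≤-trans v>0 (m≤m+n (length v) (m * length v))))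

  primitive⇒¬hasProperPeriod : ∀ {w : Word n} → Primitive w → ¬ HasProperPeriod w
  primitive⇒¬hasProperPeriod (_ , _) (g , g<w , divides zero w≡0 , _) = n≮0 (subst (g <_) w≡0 g<w)
  primitive⇒¬hasProperPeriod {w} (_ , root) (g , g<w , divides (suc m) w≡[1+m]g , P)
    with refl ← root (take g w) (suc m) (s≤s z≤n) (periodic⇒^ʷ (suc m) w (trans (*-comm g (suc m)) (sym w≡[1+m]g)) P)
    = <-irrefl (sym (trans w≡[1+m]g (+-identityʳ g))) g<w

  ¬hasProperPeriod⇒primitive : ∀ {w : Word n} → w ≢ [] → ¬ HasProperPeriod w → Primitive w
  ¬hasProperPeriod⇒primitive {w} w≢[] aperiodic = w≢[] , root
    where
    root : ∀ v m → 1 ≤ m → w ≡ v ^ʷ m → m ≡ 1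
    root v 1 _ _ = refl
    root [] (suc (suc m)) _ w≡[] = contradiction (trans w≡[] ([]-^ʷ m)) w≢[]
    root v@(_ ∷ _) (suc (suc m)) _ refl = contradiction (^ʷ-hasProperPeriod v m z<s) aperiodic

  periodic? : ∀ g (w : Word n) → Dec (Periodic g (at w) (length w))
  periodic? g w = map′ (λ h i _ i+g<w → h (≤-<-trans (m≤m+n i g) i+g<w) i+g<w)
                       (λ P {i} _ → P i z≤n)
                       (allUpTo? (λ i → (i + g <? length w) →-dec ≡-dec Fin._≟_ (at w i) (at w (i + g))) (length w))

  hasProperPeriod? : (w : Word n) → Dec (HasProperPeriod w)
  hasProperPeriod? w = anyUpTo? (λ g → (g ∣? length w) ×-dec periodic? g w) (length w)

  primitive? : (w : Word n) → Dec (Primitive w)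
  primitive? []        = no λ ([]≢[] , _) → []≢[] refl
  primitive? w@(_ ∷ _) = map′ (¬hasProperPeriod⇒primitive (λ ())) primitive⇒¬hasProperPeriod (¬? (hasProperPeriod? w))

  -- ¬ Primitive w only refutes aperiodicity; decidability recovers an actual period.
  ¬primitive⇒hasProperPeriod : ∀ {w : Word n} → w ≢ [] → ¬ Primitive w → HasProperPeriod w
  ¬primitive⇒hasProperPeriod {w} w≢[] ¬primitive =
    decidable-stable (hasProperPeriod? w) (¬primitive ∘ ¬hasProperPeriod⇒primitive w≢[])

coprime-*≡*⇒∃ : ∀ {a b m n} .{{_ : NonZero n}} → Coprime m n → a * m ≡ b * n → ∃[ t ] a ≡ t * n × b ≡ t * m
coprime-*≡*⇒∃ {a} {b} {m} {n} m⊥n am≡bn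
  with divides t a≡tn ← coprime-divisor (Coprime.sym m⊥n) (divides b (trans (*-comm m a) am≡bn)) =
  t , a≡tn , *-cancelʳ-≡ b (t * m) n (begin
    b * n     ≡⟨ am≡bn ⟨
    a * m     ≡⟨ cong (_* m) a≡tn ⟩
    t * n * m ≡⟨ *-assoc t n m ⟩
    t * (n * m) ≡⟨ cong (t *_) (*-comm n m) ⟩
    t * (m * n) ≡⟨ *-assoc t m n ⟨
    t * m * n ∎)

[m+n]*o≡p⇒m*o≤p : ∀ m n o {p} → (m + n) * o ≡ p → m * o ≤ p
[m+n]*o≡p⇒m*o≤p m n o eq = subst (m * o ≤_) eq (*-monoˡ-≤ o (m≤m+n m n))

-- Fine–Wilf bound for x q x (length 4K) with a proper period V and the period |x q| = 3K.
xqx-periods-bound : ∀ K V j → (2 + j) * V ≡ 4 * K → ∃[ d ] d ∣ V × d ∣ 3 * K × V + 3 * K ≤ 4 * K + d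
xqx-periods-bound K V zero 2V≡4K =
  K , divides 2 V≡2K , divides 3 refl , ≤-reflexive (trans (cong (_+ 3 * K) V≡2K) (lemma K))
  where
  V≡2K : V ≡ 2 * K
  V≡2K = *-cancelˡ-≡ V (2 * K) 2 (trans 2V≡4K (*-assoc 2 2 K))
  lemma : ∀ K → 2 * K + 3 * K ≡ 4 * K + K
  lemma = solve-∀
xqx-periods-bound K V 1 3V≡4K
  with t , refl , refl ← coprime-*≡*⇒∃ {V} {K} {3} {4} (gcd≡1⇒coprime refl)
                           (trans (*-comm V 3) (trans 3V≡4K (*-comm 4 K))) =
  t , divides 4 (*-comm t 4) , divides 9 (lemma₁ t) , ≤-reflexive (lemma₂ t)
  where
  lemma₁ : ∀ t → 3 * (t * 3) ≡ 9 * t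
  lemma₁ = solve-∀
  lemma₂ : ∀ t → t * 4 + 3 * (t * 3) ≡ 4 * (t * 3) + t
  lemma₂ = solve-∀
xqx-periods-bound K V (suc (suc j)) [4+j]V≡4K = 1 , 1∣ V , 1∣ (3 * K) ,
  ≤-trans (+-monoˡ-≤ (3 * K) V≤K) (≤-trans (≤-reflexive (lemma K)) (m≤m+n (4 * K) 1))
  where
  V≤K : V ≤ K
  V≤K = *-cancelˡ-≤ 4 ([m+n]*o≡p⇒m*o≤p 4 j V [4+j]V≡4K)
  lemma : ∀ K → K + 3 * K ≡ 4 * K
  lemma = solve-∀

-- Fine–Wilf bound for q (length 2K) with a proper period g₁ and the period g₂ inherited
-- from a proper period of x q (length 3K).
q-xq-periods-bound : ∀ K g₁ g₂ i j → (2 + i) * g₁ ≡ 2 * K → (2 + j) * g₂ ≡ 3 * K →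
                     ∃[ d ] d ∣ g₁ × d ∣ g₂ × g₁ + g₂ ≤ 2 * K + d
q-xq-periods-bound K g₁ g₂ i (suc j) [2+i]g₁≡2K [3+j]g₂≡3K =
  1 , 1∣ g₁ , 1∣ g₂ , ≤-trans (+-mono-≤ g₁≤K g₂≤K) (≤-trans (≤-reflexive (lemma K)) (m≤m+n (2 * K) 1))
  where
  g₁≤K : g₁ ≤ K
  g₁≤K = *-cancelˡ-≤ 2 ([m+n]*o≡p⇒m*o≤p 2 i g₁ [2+i]g₁≡2K)
  g₂≤K : g₂ ≤ K
  g₂≤K = *-cancelˡ-≤ 3 ([m+n]*o≡p⇒m*o≤p 3 j g₂ [3+j]g₂≡3K)
  lemma : ∀ K → K + K ≡ 2 * K
  lemma = solve-∀
q-xq-periods-bound K g₁ g₂ zero zero 2g₁≡2K 2g₂≡3K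
  with refl ← *-cancelˡ-≡ g₁ K 2 2g₁≡2K
  with t , refl , refl ← coprime-*≡*⇒∃ {g₂} {g₁} {2} {3} (gcd≡1⇒coprime refl)
                           (trans (*-comm g₂ 2) (trans 2g₂≡3K (*-comm 3 g₁))) =
  t , divides 2 (*-comm t 2) , divides 3 (*-comm t 3) , ≤-reflexive (lemma t)
  where
  lemma : ∀ t → t * 2 + t * 3 ≡ 2 * (t * 2) + t
  lemma = solve-∀
q-xq-periods-bound K g₁ g₂ 1 zero 3g₁≡2K 2g₂≡3K
  with t , refl , refl ← coprime-*≡*⇒∃ {g₁} {K} {3} {2} (gcd≡1⇒coprime refl)
                           (trans (*-comm g₁ 3) (trans 3g₁≡2K (*-comm 2 K)))
  with s , refl , refl ← coprime-*≡*⇒∃ {g₂} {t} {2} {9} (gcd≡1⇒coprime refl)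
                           (trans (*-comm g₂ 2) (trans 2g₂≡3K (trans (*-comm 3 (t * 3)) (*-assoc t 3 3)))) =
  s , divides 4 (lemma₁ s) , divides 9 (*-comm s 9) , ≤-reflexive (lemma₂ s)
  where
  lemma₁ : ∀ s → s * 2 * 2 ≡ 4 * s
  lemma₁ = solve-∀
  lemma₂ : ∀ s → s * 2 * 2 + s * 9 ≡ 2 * (s * 2 * 3) + s
  lemma₂ = solve-∀
q-xq-periods-bound K g₁ g₂ (suc (suc i)) zero [4+i]g₁≡2K 2g₂≡3K =
  1 , 1∣ g₁ , 1∣ g₂ , ≤-trans (*-cancelˡ-≤ 4 4[g₁+g₂]≤4[2K]) (m≤m+n (2 * K) 1)
  where
  lemma₁ : ∀ g₁ g₂ → 4 * (g₁ + g₂) ≡ 4 * g₁ + 2 * (2 * g₂)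
  lemma₁ = solve-∀
  lemma₂ : ∀ K → 2 * K + 2 * (3 * K) ≡ 4 * (2 * K)
  lemma₂ = solve-∀
  4[g₁+g₂]≤4[2K] : 4 * (g₁ + g₂) ≤ 4 * (2 * K)
  4[g₁+g₂]≤4[2K] = subst₂ _≤_ (sym (lemma₁ g₁ g₂)) (lemma₂ K)
    (+-mono-≤ ([m+n]*o≡p⇒m*o≤p 4 i g₁ [4+i]g₁≡2K) (≤-reflexive (cong (2 *_) 2g₂≡3K)))

∣∧<⇒[2+i]*m≡n : ∀ {m n} → m ∣ n → m < n → ∃[ i ] (2 + i) * m ≡ n
∣∧<⇒[2+i]*m≡n (divides zero    refl) ()
∣∧<⇒[2+i]*m≡n {m} (divides (suc zero) refl) m<m+0 = ⊥-elim (<-irrefl (sym (+-identityʳ m)) m<m+0)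
∣∧<⇒[2+i]*m≡n (divides (suc (suc i)) n≡[2+i]m) _ = i , sym n≡[2+i]m

m+[o+m]≡n+[o+n]⇒m≡n : ∀ m n o → m + (o + m) ≡ n + (o + n) → m ≡ n
m+[o+m]≡n+[o+n]⇒m≡n m n o eq with <-cmp m n
... | tri< m<n _ _ = ⊥-elim (<-irrefl eq (+-mono-< m<n (+-monoʳ-< o m<n)))
... | tri≈ _ m≡n _ = m≡n
... | tri> _ _ n<m = ⊥-elim (<-irrefl (sym eq) (+-mono-< n<m (+-monoʳ-< o n<m)))

∣∧<⇒0< : ∀ {m n} → m ∣ n → m < n → 0 < m
∣∧<⇒0< {zero}  (divides q n≡q*0) 0<n = contradiction (trans n≡q*0 (*-zeroʳ q)) (m<n⇒n≢0 0<n)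
∣∧<⇒0< {suc m} _                 _   = z<s

-- The words x q x with |q| = 2 |x|

module _ {n : ℕ} where

  length-x++q : ∀ (x q : Word n) → length q ≡ 2 * length x → length (x ++ q) ≡ 3 * length x
  length-x++q x q q≡2K = trans (length-++ x) (trans (cong (length x +_) q≡2K) (lemma (length x)))
    where
    lemma : ∀ K → K + 2 * K ≡ 3 * K
    lemma = solve-∀

  primitive-xqx : ∀ (x q : Word n) → length q ≡ 2 * length x → 0 < length x →
                  Primitive (x ++ q) → Primitive (x ++ q ++ x)
  primitive-xqx x q q≡2K K>0 xq-primitive = ¬hasProperPeriod⇒primitive w≢[] aperiodic
    where
    K = length x
    xq≡3K : length (x ++ q) ≡ 3 * K
    xq≡3K = length-x++q x q q≡2K
    xq++x≡xqx : (x ++ q) ++ x ≡ x ++ q ++ x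
    xq++x≡xqx = ++-assoc x q x
    w≡4K : length (x ++ q ++ x) ≡ 4 * K
    w≡4K = trans (cong length (sym xq++x≡xqx)) (trans (length-++ (x ++ q)) (trans (cong (_+ K) xq≡3K) (lemma K)))
      where
      lemma : ∀ K → 3 * K + K ≡ 4 * K
      lemma = solve-∀
    w≢[] : x ++ q ++ x ≢ []
    w≢[] w≡[] = <-irrefl (trans (sym (cong length w≡[])) w≡4K) (*-monoʳ-< 4 K>0)
    aperiodic : ¬ HasProperPeriod (x ++ q ++ x)
    aperiodic (V , V<w , V∣w , P-V)
      with j , [2+j]V≡w ← ∣∧<⇒[2+i]*m≡n V∣w V<w
      with d , d∣V , d∣3K , bound ← xqx-periods-bound K V j (trans [2+j]V≡w w≡4K) =
      primitive⇒¬hasProperPeriod xq-primitive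
        (gcd V (3 * K) , G<xq , subst (gcd V (3 * K) ∣_) (sym xq≡3K) (gcd[m,n]∣n V (3 * K)) , P-G-xq)
      where
      V>0 : 0 < V
      V>0 = ∣∧<⇒0< V∣w V<w
      P-3K : Periodic (3 * K) (at (x ++ q ++ x)) (length (x ++ q ++ x))
      P-3K = subst (λ p → Periodic p (at (x ++ q ++ x)) (length (x ++ q ++ x))) xq≡3K (bordered-periodic x q)
      P-G : Periodic (gcd V (3 * K)) (at (x ++ q ++ x)) (length (x ++ q ++ x))
      P-G = fine-wilf-∣ V>0 d∣V d∣3K (subst (λ L → V + 3 * K ≤ L + d) (sym w≡4K) bound) P-V P-3K
      P-G-xq : Periodic (gcd V (3 * K)) (at (x ++ q)) (length (x ++ q))
      P-G-xq = periodic-prefix (x ++ q) (subst (λ w → Periodic (gcd V (3 * K)) (at w) (length w)) (sym xq++x≡xqx) P-G)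
      V≤2K : V ≤ 2 * K
      V≤2K = *-cancelˡ-≤ 2 (subst (2 * V ≤_) (trans w≡4K (*-assoc 2 2 K)) ([m+n]*o≡p⇒m*o≤p 2 j V [2+j]V≡w))
      G<xq : gcd V (3 * K) < length (x ++ q)
      G<xq = ≤-<-trans (∣⇒≤ ⦃ >-nonZero V>0 ⦄ (gcd[m,n]∣m V (3 * K)))
               (≤-<-trans V≤2K (subst (2 * K <_) (sym xq≡3K) (*-monoˡ-< K ⦃ >-nonZero K>0 ⦄ (n<1+n 2))))

  x-periodic⇒q≡xx : ∀ (x q : Word n) → length q ≡ 2 * length x →
                    Periodic (length x) (at (x ++ q)) (length (x ++ q)) → q ≡ x ++ x
  x-periodic⇒q≡xx x q q≡2K P = ++-cancelˡ x q (x ++ x) (begin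
    x ++ q                      ≡⟨ periodic⇒^ʷ 3 (x ++ q) (trans (*-comm (length x) 3) (sym (length-x++q x q q≡2K))) P ⟩
    take (length x) (x ++ q) ^ʷ 3 ≡⟨ cong (_^ʷ 3) (take-length-++ x) ⟩
    x ++ x ++ x ++ []           ≡⟨ cong (λ u → x ++ x ++ u) (++-identityʳ x) ⟩
    x ++ x ++ x                 ∎)

  properPeriods⇒q≡xx : ∀ (x q : Word n) → length q ≡ 2 * length x →
                       HasProperPeriod q → HasProperPeriod (x ++ q) → q ≡ x ++ x
  properPeriods⇒q≡xx x q q≡2K (g₁ , g₁<q , g₁∣q , P₁) (g₂ , g₂<xq , g₂∣xq , P₂)
    with i , [2+i]g₁≡q ← ∣∧<⇒[2+i]*m≡n g₁∣q g₁<q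
    with j , [2+j]g₂≡xq ← ∣∧<⇒[2+i]*m≡n g₂∣xq g₂<xq
    with d , d∣g₁ , d∣g₂ , bound ← q-xq-periods-bound (length x) g₁ g₂ i j
                                     (trans [2+i]g₁≡q q≡2K) (trans [2+j]g₂≡xq (length-x++q x q q≡2K)) =
    x-periodic⇒q≡xx x q q≡2K (periodicFrom-∣ G∣K P-G)
    where
    K = length x
    G = gcd g₁ g₂
    [2+i]g₁≡2K : (2 + i) * g₁ ≡ 2 * K
    [2+i]g₁≡2K = trans [2+i]g₁≡q q≡2K
    [2+j]g₂≡3K : (2 + j) * g₂ ≡ 3 * K
    [2+j]g₂≡3K = trans [2+j]g₂≡xq (length-x++q x q q≡2K)
    g₁>0 : 0 < g₁
    g₁>0 = ∣∧<⇒0< g₁∣q g₁<q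
    G>0 : 0 < G
    G>0 = n≢0⇒n>0 (gcd[m,n]≢0 g₁ g₂ (inj₁ (m<n⇒n≢0 g₁>0)))
    P-G-q : Periodic G (at q) (length q)
    P-G-q = fine-wilf-∣ g₁>0 d∣g₁ d∣g₂ (subst (λ L → g₁ + g₂ ≤ L + d) (sym q≡2K) bound)
                        P₁ (periodic-suffix x P₂)
    g₂≤2K : g₂ ≤ 2 * K
    g₂≤2K = *-cancelˡ-≤ 2 (≤-trans ([m+n]*o≡p⇒m*o≤p 2 j g₂ [2+j]g₂≡3K)
                                   (≤-trans (*-monoˡ-≤ K (n≤1+n 3)) (≤-reflexive (*-assoc 2 2 K))))
    K+g₂≤xq : K + g₂ ≤ length (x ++ q)
    K+g₂≤xq = subst (K + g₂ ≤_) (sym (length-++ x)) (+-monoʳ-≤ K (subst (g₂ ≤_) (sym q≡2K) g₂≤2K))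
    P-G : Periodic G (at (x ++ q)) (length (x ++ q))
    P-G = periodicFrom⇒periodic K (gcd[m,n]∣n g₁ g₂) (∣∧<⇒0< g₂∣xq g₂<xq) G>0 K+g₂≤xq P₂
            (periodic⇒periodicFrom-++ x P-G-q)
    G∣K : G ∣ K
    G∣K = ∣m+n∣m⇒∣n (subst (G ∣_) (lemma K) (∣-trans (gcd[m,n]∣n g₁ g₂) (divides (2 + j) (sym [2+j]g₂≡3K))))
                    (∣-trans (gcd[m,n]∣m g₁ g₂) (divides (2 + i) (sym [2+i]g₁≡2K)))
      where
      lemma : ∀ K → 3 * K ≡ 2 * K + K
      lemma = solve-∀

  ¬primitive-^ʷ : ∀ (v : Word n) m → ¬ Primitive (v ^ʷ (2 + m))
  ¬primitive-^ʷ v m (_ , root) with () ← root v (2 + m) (s≤s z≤n) refl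

  ¬primitive-q-xq⇒q≡xx : ∀ (x q : Word n) → length q ≡ 2 * length x → 0 < length x →
                         ¬ Primitive q → ¬ Primitive (x ++ q) → q ≡ x ++ x
  ¬primitive-q-xq⇒q≡xx x q q≡2K K>0 ¬q-primitive ¬xq-primitive = properPeriods⇒q≡xx x q q≡2K
    (¬primitive⇒hasProperPeriod (nonempty q≡2K (*-monoʳ-< 2 K>0)) ¬q-primitive)
    (¬primitive⇒hasProperPeriod (nonempty (length-x++q x q q≡2K) (*-monoʳ-< 3 K>0)) ¬xq-primitive)
    where
    nonempty : ∀ {w : Word n} {L} → length w ≡ L → 0 < L → w ≢ []
    nonempty w≡L 0<L refl = n≮0 (subst (0 <_) (sym w≡L) 0<L)

-- Counting

length-cartesianProduct : ∀ {A B : Set} (xs : List A) (ys : List B) →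
                          length (cartesianProduct xs ys) ≡ length xs * length ys
length-cartesianProduct []       ys = refl
length-cartesianProduct (x ∷ xs) ys = begin
  length (map (x ,_) ys ++ cartesianProduct xs ys)         ≡⟨ length-++ (map (x ,_) ys) ⟩
  length (map (x ,_) ys) + length (cartesianProduct xs ys) ≡⟨ cong₂ _+_ (length-map (x ,_) ys)
                                                                       (length-cartesianProduct xs ys) ⟩
  length ys + length xs * length ys                        ∎

module _ {A : Set} where

  HasCard-⇔ : ∀ {P Q : A → Set} {c} → (∀ x → P x ⇔ Q x) → HasCard P c → HasCard Q c
  HasCard-⇔ P⇔Q (xs , xs! , ∈xs⇔P , |xs|≡c) = xs , xs! , (λ x → ⇔.trans (∈xs⇔P x) (P⇔Q x)) , |xs|≡c

  HasCard-unique : ∀ {P : A → Set} {a b} → HasCard P a → HasCard P b → a ≡ b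
  HasCard-unique (xs , xs! , ∈xs⇔P , refl) (ys , ys! , ∈ys⇔P , refl) =
    ↭-length (∼bag⇒↭ (unique∧set⇒bag xs! ys! λ {x} → ⇔.trans (∈xs⇔P x) (⇔.sym (∈ys⇔P x))))

  HasCard-filter : ∀ {P : A → Set} (P? : Decidable P) {xs} → Unique xs →
                   HasCard (λ x → x ∈ xs × P x) (length (filter P? xs))
  HasCard-filter P? xs! = _ , filter⁺ P? xs! , (λ x → mk⇔ (∈-filter⁻ P?) (uncurry (∈-filter⁺ P?))) , refl

  HasCard-map : ∀ {B : Set} {P : A → Set} {f : A → B} {c} → (∀ {x y} → f x ≡ f y → x ≡ y) →
                HasCard P c → HasCard (λ y → ∃[ x ] P x × y ≡ f x) c
  HasCard-map {P = P} {f} f-injective (xs , xs! , ∈xs⇔P , refl) =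
    map f xs , map⁺ f-injective xs! , (λ y → mk⇔ to-image from-image) , length-map f xs
    where
    to-image : ∀ {y} → y ∈ map f xs → ∃[ x ] P x × y ≡ f x
    to-image y∈ with x , x∈xs , refl ← ∈-map⁻ f y∈ = x , Equivalence.to (∈xs⇔P x) x∈xs , refl
    from-image : ∀ {y} → ∃[ x ] P x × y ≡ f x → y ∈ map f xs
    from-image (x , Px , refl) = ∈-map⁺ f (Equivalence.from (∈xs⇔P x) Px)

  HasCard-× : ∀ {B : Set} {P : A → Set} {Q : B → Set} {a b} →
              HasCard P a → HasCard Q b → HasCard (λ (x , y) → P x × Q y) (a * b)
  HasCard-× {P = P} {Q} (xs , xs! , ∈xs⇔P , refl) (ys , ys! , ∈ys⇔Q , refl) =
    cartesianProduct xs ys , cartesianProduct⁺ xs! ys! , (λ (x , y) → ∈xs×ys⇔ x y) , length-cartesianProduct xs ys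
    where
    ∈xs×ys⇔ : ∀ x y → (x , y) ∈ cartesianProduct xs ys ⇔ (P x × Q y)
    ∈xs×ys⇔ x y = mk⇔
      (λ xy∈ → let x∈ , y∈ = ∈-cartesianProduct⁻ xs ys xy∈
               in Equivalence.to (∈xs⇔P x) x∈ , Equivalence.to (∈ys⇔Q y) y∈)
      (λ (Px , Qy) → ∈-cartesianProduct⁺ (Equivalence.from (∈xs⇔P x) Px) (Equivalence.from (∈ys⇔Q y) Qy))

  private
    +-suc-middle : ∀ p q c → p + suc q + c ≡ suc (p + q + c)
    +-suc-middle p q c = cong (_+ c) (+-suc p q)

  filter-inclusion-exclusion : ∀ {P Q : A → Set} (P? : Decidable P) (Q? : Decidable Q) xs →
    length (filter (P? ∩? Q?) xs) + length xs ≡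
    length (filter P? xs) + length (filter Q? xs) + length (filter (∁? P? ∩? ∁? Q?) xs)
  filter-inclusion-exclusion P? Q? [] = refl
  filter-inclusion-exclusion P? Q? (x ∷ xs) with P? x | Q? x | filter-inclusion-exclusion P? Q? xs
  ... | yes _ | yes _ | ih = cong suc (trans (+-suc _ _) (trans (cong suc ih) (sym (+-suc-middle (length (filter P? xs)) _ _))))
  ... | yes _ | no  _ | ih = trans (+-suc _ _) (cong suc ih)
  ... | no  _ | yes _ | ih = trans (+-suc _ _) (trans (cong suc ih) (sym (+-suc-middle (length (filter P? xs)) _ _)))
  ... | no  _ | no  _ | ih = trans (+-suc _ _) (trans (cong suc ih) (sym (+-suc _ _)))


HasCard-Fin : ∀ n → HasCard (λ (_ : Fin n) → ⊤) n
HasCard-Fin n = allFin n , allFin⁺ n , (λ i → mk⇔ _ (λ _ → ∈-allFin i)) , length-tabulate id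

HasCard-length : ∀ n L → HasCard (λ (w : Word n) → length w ≡ L) (n ^ L)
HasCard-length n zero = [] ∷ [] , All.[] AllPairs.∷ AllPairs.[] , ∈[[]]⇔ , refl
  where
  ∈[[]]⇔ : ∀ (w : Word n) → w ∈ [] ∷ [] ⇔ length w ≡ 0
  ∈[[]]⇔ []      = mk⇔ (λ _ → refl) (λ _ → here refl)
  ∈[[]]⇔ (_ ∷ _) = mk⇔ (λ { (here ()) }) (λ ())
HasCard-length n (suc L) =
  HasCard-⇔ cons⇔ (HasCard-map ∷-injective′ (HasCard-× (HasCard-Fin n) (HasCard-length n L)))
  where
  ∷-injective′ : ∀ {cu dv : Fin n × Word n} → uncurry _∷_ cu ≡ uncurry _∷_ dv → cu ≡ dv
  ∷-injective′ refl = refl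
  cons⇔ : ∀ w → (∃[ cu ] (⊤ × length (proj₂ cu) ≡ L) × w ≡ uncurry _∷_ cu) ⇔ (length w ≡ suc L)
  cons⇔ []      = mk⇔ (λ { (_ , _ , ()) }) (λ ())
  cons⇔ (c ∷ u) = mk⇔ (λ { (_ , (_ , |u|≡L) , refl) → cong suc |u|≡L })
                      (λ |cu|≡1+L → (c , u) , (_ , suc-injective |cu|≡1+L) , refl)

module Counting (n k : ℕ) (k>0 : 0 < k) where

  Shape : Word n × Word n → Set
  Shape (x , q) = length x ≡ k × length q ≡ 2 * k

  universe : HasCard Shape (n ^ k * n ^ (2 * k))
  universe = HasCard-× (HasCard-length n k) (HasCard-length n (2 * k))

  U : List (Word n × Word n)
  U = proj₁ universe

  U! : Unique U
  U! = proj₁ (proj₂ universe)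

  ∈U⇔ : ∀ z → z ∈ U ⇔ Shape z
  ∈U⇔ = proj₁ (proj₂ (proj₂ universe))

  PrimitiveQ PrimitiveXQ : Word n × Word n → Set
  PrimitiveQ  (x , q) = Primitive q
  PrimitiveXQ (x , q) = Primitive (x ++ q)

  primitiveQ? : Decidable PrimitiveQ
  primitiveQ? (x , q) = primitive? q

  primitiveXQ? : Decidable PrimitiveXQ
  primitiveXQ? (x , q) = primitive? (x ++ q)

  shape⇒length-xq : ∀ (x q : Word n) → length x ≡ k → length q ≡ 2 * k → length (x ++ q) ≡ 3 * k
  shape⇒length-xq x q refl q≡2k = length-x++q x q q≡2k

  length-U : length U ≡ n ^ (3 * k)
  length-U = begin
    length U              ≡⟨ proj₂ (proj₂ (proj₂ universe)) ⟩
    n ^ k * n ^ (2 * k)   ≡⟨ ^-distribˡ-+-* n k (2 * k) ⟨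
    n ^ (k + 2 * k)       ≡⟨ cong (n ^_) (lemma k) ⟩
    n ^ (3 * k)           ∎
    where
    lemma : ∀ k → k + 2 * k ≡ 3 * k
    lemma = solve-∀

  count-q : ∀ {a} → HasCard (PrimOfLength n (2 * k)) a → length (filter primitiveQ? U) ≡ n ^ k * a
  count-q A = HasCard-unique (HasCard-filter primitiveQ? U!) (HasCard-⇔ shape⇔ (HasCard-× (HasCard-length n k) A))
    where
    shape⇔ : ∀ z → (length (proj₁ z) ≡ k × PrimOfLength n (2 * k) (proj₂ z)) ⇔ (z ∈ U × PrimitiveQ z)
    shape⇔ z = mk⇔ (λ (x≡k , q≡2k , q-primitive) → Equivalence.from (∈U⇔ z) (x≡k , q≡2k) , q-primitive)
                   (λ (z∈U , q-primitive) → let x≡k , q≡2k = Equivalence.to (∈U⇔ z) z∈U in x≡k , q≡2k , q-primitive)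

  split : Word n → Word n × Word n
  split w = take k w , drop k w

  split-injective : ∀ {v w} → split v ≡ split w → v ≡ w
  split-injective {v} {w} eq = begin
    v                    ≡⟨ take++drop≡id k v ⟨
    take k v ++ drop k v ≡⟨ cong₂ _++_ (cong proj₁ eq) (cong proj₂ eq) ⟩
    take k w ++ drop k w ≡⟨ take++drop≡id k w ⟩
    w                    ∎

  count-xq : ∀ {b} → HasCard (PrimOfLength n (3 * k)) b → length (filter primitiveXQ? U) ≡ b
  count-xq B = HasCard-unique (HasCard-filter primitiveXQ? U!) (HasCard-⇔ split⇔ (HasCard-map split-injective B))
    where
    split⇔ : ∀ z → (∃[ w ] PrimOfLength n (3 * k) w × z ≡ split w) ⇔ (z ∈ U × PrimitiveXQ z)
    split⇔ (x , q) = mk⇔ to from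
      where
      to : (∃[ w ] PrimOfLength n (3 * k) w × (x , q) ≡ split w) → (x , q) ∈ U × Primitive (x ++ q)
      to (w , (w≡3k , w-primitive) , refl) =
        Equivalence.from (∈U⇔ _) (take≡k , drop≡2k) , subst Primitive (sym (take++drop≡id k w)) w-primitive
        where
        take≡k : length (take k w) ≡ k
        take≡k = trans (length-take k w) (m≤n⇒m⊓n≡m (subst (k ≤_) (sym w≡3k) (m≤n*m k 3)))
        drop≡2k : length (drop k w) ≡ 2 * k
        drop≡2k = trans (length-drop k w) (trans (cong (_∸ k) (trans w≡3k (lemma k))) (m+n∸m≡n k (2 * k)))
          where
          lemma : ∀ k → 3 * k ≡ k + 2 * k
          lemma = solve-∀
      from : (x , q) ∈ U × Primitive (x ++ q) → ∃[ w ] PrimOfLength n (3 * k) w × (x , q) ≡ split w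
      from (xq∈U , xq-primitive) with x≡k , q≡2k ← Equivalence.to (∈U⇔ _) xq∈U =
        x ++ q , (shape⇒length-xq x q x≡k q≡2k , xq-primitive) ,
        subst (λ m → (x , q) ≡ (take m (x ++ q) , drop m (x ++ q))) x≡k
              (sym (cong₂ _,_ (take-length-++ x) (drop-length-++ x)))

  sandwich : Word n × Word n → Word n × Word n
  sandwich (x , q) = x ++ q ++ x , q

  sandwich-injective : ∀ {z z′} → sandwich z ≡ sandwich z′ → z ≡ z′
  sandwich-injective {x , q} {x′ , q′} eq with refl ← cong proj₂ eq = cong (_, q) (begin
    x                            ≡⟨ take-length-++ x ⟨
    take (length x) (x ++ q ++ x)   ≡⟨ cong₂ take x≡x′ (cong proj₁ eq) ⟩
    take (length x′) (x′ ++ q ++ x′) ≡⟨ take-length-++ x′ ⟩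
    x′                           ∎)
    where
    x≡x′ : length x ≡ length x′
    x≡x′ = m+[o+m]≡n+[o+n]⇒m≡n (length x) (length x′) (length q) (begin
      length x + (length q + length x)  ≡⟨ cong (length x +_) (length-++ q) ⟨
      length x + length (q ++ x)        ≡⟨ length-++ x ⟨
      length (x ++ q ++ x)              ≡⟨ cong (length ∘ proj₁) eq ⟩
      length (x′ ++ q ++ x′)            ≡⟨ length-++ x′ ⟩
      length x′ + length (q ++ x′)      ≡⟨ cong (length x′ +_) (length-++ q) ⟩
      length x′ + (length q + length x′) ∎)

  count-both : ∀ {e} → HasCard (InE1 n (2 * k)) e → length (filter (primitiveQ? ∩? primitiveXQ?) U) ≡ e
  count-both E = HasCard-unique
    (HasCard-⇔ sandwich⇔ (HasCard-map sandwich-injective (HasCard-filter (primitiveQ? ∩? primitiveXQ?) U!))) E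
    where
    sandwich⇔ : ∀ pq → (∃[ z ] (z ∈ U × (PrimitiveQ ∩ PrimitiveXQ) z) × pq ≡ sandwich z) ⇔ InE1 n (2 * k) pq
    sandwich⇔ (p , q) = mk⇔ to from
      where
      to : (∃[ z ] (z ∈ U × (PrimitiveQ ∩ PrimitiveXQ) z) × (p , q) ≡ sandwich z) → InE1 n (2 * k) (p , q)
      to ((x , q) , (xq∈U , q-primitive , xq-primitive) , refl)
        with x≡k , q≡2k ← Equivalence.to (∈U⇔ _) xq∈U =
        primitive-xqx x q q≡2x x>0 xq-primitive , q-primitive , p≡4k , q≡2k , ¬pq-primitive ,
        x , x≢[] , refl , xq-primitive , q≡2x
        where
        q≡2x : length q ≡ 2 * length x
        q≡2x = trans q≡2k (cong (2 *_) (sym x≡k))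
        x>0 : 0 < length x
        x>0 = subst (0 <_) (sym x≡k) k>0
        x≢[] : x ≢ []
        x≢[] refl = n≮0 x>0
        p≡4k : length (x ++ q ++ x) ≡ 2 * (2 * k)
        p≡4k = begin
          length (x ++ q ++ x)             ≡⟨ length-++ x ⟩
          length x + length (q ++ x)       ≡⟨ cong (length x +_) (length-++ q) ⟩
          length x + (length q + length x) ≡⟨ cong₂ (λ a b → a + (b + a)) x≡k q≡2k ⟩
          k + (2 * k + k)                  ≡⟨ lemma k ⟩
          2 * (2 * k)                      ∎
          where
          lemma : ∀ k → k + (2 * k + k) ≡ 2 * (2 * k)
          lemma = solve-∀
        ¬pq-primitive : ¬ Primitive ((x ++ q ++ x) ++ q)
        ¬pq-primitive = ¬primitive-^ʷ (x ++ q) 0 ∘ subst Primitive (begin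
          (x ++ q ++ x) ++ q         ≡⟨ ++-assoc x (q ++ x) q ⟩
          x ++ (q ++ x) ++ q         ≡⟨ cong (x ++_) (++-assoc q x q) ⟩
          x ++ q ++ x ++ q           ≡⟨ ++-assoc x q (x ++ q) ⟨
          (x ++ q) ++ x ++ q         ≡⟨ cong (λ u → (x ++ q) ++ u) (++-identityʳ (x ++ q)) ⟨
          (x ++ q) ^ʷ 2              ∎)
      from : InE1 n (2 * k) (p , q) → ∃[ z ] (z ∈ U × (PrimitiveQ ∩ PrimitiveXQ) z) × (p , q) ≡ sandwich z
      from (_ , q-primitive , _ , q≡2k , _ , x , _ , refl , xq-primitive , q≡2x) =
        (x , q) , (Equivalence.from (∈U⇔ _) (x≡k , q≡2k) , q-primitive , xq-primitive) , refl
        where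
        x≡k : length x ≡ k
        x≡k = *-cancelˡ-≡ (length x) k 2 (trans (sym q≡2x) q≡2k)

  double : Word n → Word n × Word n
  double x = x , x ++ x

  count-neither : length (filter (∁? primitiveQ? ∩? ∁? primitiveXQ?) U) ≡ n ^ k
  count-neither = HasCard-unique (HasCard-filter (∁? primitiveQ? ∩? ∁? primitiveXQ?) U!)
    (HasCard-⇔ double⇔ (HasCard-map (cong proj₁) (HasCard-length n k)))
    where
    double⇔ : ∀ z → (∃[ x ] length x ≡ k × z ≡ double x) ⇔ (z ∈ U × (∁ PrimitiveQ ∩ ∁ PrimitiveXQ) z)
    double⇔ (x , q) = mk⇔ to from
      where
      to : (∃[ x′ ] length x′ ≡ k × (x , q) ≡ double x′) → (x , q) ∈ U × ¬ Primitive q × ¬ Primitive (x ++ q)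
      to (x , x≡k , refl) =
        Equivalence.from (∈U⇔ _) (x≡k , trans (length-++ x) (cong₂ _+_ x≡k (trans x≡k (sym (+-identityʳ k))))) ,
        ¬primitive-^ʷ x 0 ∘ subst Primitive (cong (x ++_) (sym (++-identityʳ x))) ,
        ¬primitive-^ʷ x 1 ∘ subst Primitive (cong (λ u → x ++ x ++ u) (sym (++-identityʳ x)))
      from : (x , q) ∈ U × ¬ Primitive q × ¬ Primitive (x ++ q) → ∃[ x′ ] length x′ ≡ k × (x , q) ≡ double x′
      from (xq∈U , ¬q-primitive , ¬xq-primitive) with x≡k , q≡2k ← Equivalence.to (∈U⇔ _) xq∈U =
        x , x≡k , cong (x ,_) (¬primitive-q-xq⇒q≡xx x q (trans q≡2k (cong (2 *_) (sym x≡k)))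
                                  (subst (0 <_) (sym x≡k) k>0) ¬q-primitive ¬xq-primitive)

proposition3p11 : (n l k m l₁ : ℕ) → 2 ≤ n → 0 < l → l ≡ 2 * k →
    l ≡ 3 ^ m * l₁ → Coprime 3 l₁ →
    (e a b : ℕ) → HasCard (InE1 n l) e → HasCard (PrimOfLength n l) a →
    HasCard (PrimOfLength n (3 * k)) b →
    e + n ^ (3 * k) ≡ n ^ k * (a + 1) + b
proposition3p11 n l k _ _ _ 0<2k refl _ _ e a b E A B = begin
  e + n ^ (3 * k)                                     ≡⟨ cong₂ _+_ (count-both E) length-U ⟨
  length (filter (primitiveQ? ∩? primitiveXQ?) U) + length U
                                                      ≡⟨ filter-inclusion-exclusion primitiveQ? primitiveXQ? U ⟩
  length (filter primitiveQ? U) + length (filter primitiveXQ? U) + length (filter (∁? primitiveQ? ∩? ∁? primitiveXQ?) U)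
                                                      ≡⟨ cong₂ _+_ (cong₂ _+_ (count-q A) (count-xq B)) count-neither ⟩
  n ^ k * a + b + n ^ k                               ≡⟨ lemma (n ^ k) a b ⟩
  n ^ k * (a + 1) + b                                 ∎
  where
  k>0 : 0 < k
  k>0 = n≢0⇒n>0 (λ k≡0 → <-irrefl (sym (cong (2 *_) k≡0)) 0<2k)
  open Counting n k k>0
  lemma : ∀ N a b → N * a + b + N ≡ N * (a + 1) + b
  lemma = solve-∀
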